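{- For every $k\in\{1,2,\dots,\frac{\ell mn}{L}\}$, the rows of the matrix $A^{(k)}$ are pairwise distinct.
   Context: Let $\ell,m,n\geq 2$ be integers, $L=\mathrm{lcm}(\ell,m,n)$ and $\lambda=\frac{n\cdot\mathrm{lcm}(\ell,m)}{L}$. Write $V(K_\ell)=\{u_1,\dots,u_\ell\}$, $V(K_m)=\{v_1,\dots,v_m\}$, $V(K_n)=\{w_1,\dots,w_n\}$, so vertices of $K_\ell\square K_m\square K_n$ are triples $(u_a,v_b,w_c)$. Let $\rho=(u_1\,u_2\,\cdots\,u_\ell)$, $\sigma=(v_1\,v_2\,\cdots\,v_m)$, $\tau=(w_1\,w_2\,\cdots\,w_n)$ be the cyclic permutations of the respective vertex sets. Define $L\times 3$ matrices $A^{(k)}=[\mathbf{c}^{(k)}\ \mathbf{d}^{(k)}\ \mathbf{e}^{(k)}]$ (columns) for $k=1,\dots,\frac{\ell mn}{L}$ as follows: row $r$ ($r=1,\dots,L$) of $A^{(1)}$ is $(\rho^{r-1}(u_1),\sigma^{r-1}(v_1),\tau^{r-1}(w_1))$; for $k>1$, $\mathbf{c}^{(k)}=\mathbf{c}^{(1)}$, and if $k\equiv 1\pmod{\lambda}$ then $\mathbf{d}^{(k)}=\sigma(\mathbf{d}^{(k-1)})$, $\mathbf{e}^{(k)}=\mathbf{e}^{(k-1)}$, while otherwise $\mathbf{d}^{(k)}=\mathbf{d}^{(k-1)}$, $\mathbf{e}^{(k)}=\tau(\mathbf{e}^{(k-1)})$ (permutations applied entrywise). Each row is regarded as a vertex of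 $K_\ell\square K_m\square K_n$. -}

module Defs where

open import Data.Nat using (ℕ; zero; suc; _*_; _∸_; _≤_; _<_; NonZero; >-nonZero; _/_)
open import Data.Nat.Properties using (<-≤-trans; m*n≢0)
open import Data.Nat.LCM using (lcm; lcm-least)
open import Data.Nat.Divisibility using (_∣_; _∣?_; m∣m*n; n∣m*n; 0∣⇒≡0)
open import Data.Nat.DivMod using (_mod_)
open import Data.Fin using (Fin; toℕ)
open import Data.Product using (_×_; _,_)
open import Relation.Nullary using (yes; no)
open import Relation.Binary.PropositionalEquality using (_≡_; subst)

lcm≢0 : ∀ a b .{{_ : NonZero a}} .{{_ : NonZero b}} → NonZero (lcm a b)
lcm≢0 a b with lcm a b | lcm-least {a} {b} {a * b} (m∣m*n b) (n∣m*n a)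
... | suc _ | _ = _
... | zero  | 0∣ab = subst NonZero (0∣⇒≡0 0∣ab) (m*n≢0 a b)

-- the cyclic permutation  x_i ↦ x_{i+1}  (indices mod p) on Fin p,
-- where Fin p index i stands for the vertex x_{i+1}
cyc : ∀ {p} → Fin p → Fin p
cyc {suc p} i = suc (toℕ i) mod suc p

iter : ∀ {A : Set} → (A → A) → ℕ → A → A
iter f zero    x = x
iter f (suc r) x = f (iter f r x)

-- The construction, for integers ℓ, m, n ≥ 2.
-- Vertex (u_a, v_b, w_c) of K_ℓ □ K_m □ K_n is represented by
-- (a-1, b-1, c-1) : Fin ℓ × Fin m × Fin n.
module Construction (ℓ m n : ℕ) (hℓ : 2 ≤ ℓ) (hm : 2 ≤ m) (hn : 2 ≤ n) where

  instance
    nzℓ : NonZero ℓ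
    nzℓ = >-nonZero (<-≤-trans (Data.Nat.s≤s Data.Nat.z≤n) hℓ)
    nzm : NonZero m
    nzm = >-nonZero (<-≤-trans (Data.Nat.s≤s Data.Nat.z≤n) hm)
    nzn : NonZero n
    nzn = >-nonZero (<-≤-trans (Data.Nat.s≤s Data.Nat.z≤n) hn)
    nzℓm : NonZero (lcm ℓ m)
    nzℓm = lcm≢0 ℓ m
    nzL : NonZero (lcm (lcm ℓ m) n)
    nzL = lcm≢0 (lcm ℓ m) n

  Vertex : Set
  Vertex = Fin ℓ × Fin m × Fin n

  L : ℕ
  L = lcm (lcm ℓ m) n

  lam : ℕ
  lam = (n * lcm ℓ m) / L

  numMatrices : ℕ
  numMatrices = (ℓ * m * n) / L

  ρ : Fin ℓ → Fin ℓ
  ρ = cyc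
  σ : Fin m → Fin m
  σ = cyc
  τ : Fin n → Fin n
  τ = cyc

  -- An L × 3 matrix, given by its three columns; row r (1 ≤ r ≤ L)
  -- is indexed by r-1 : Fin L.
  Matrix : Set
  Matrix = (Fin L → Fin ℓ) × (Fin L → Fin m) × (Fin L → Fin n)

  row : Matrix → Fin L → Vertex
  row (c , d , e) r = c r , d r , e r

  A₁ : Matrix
  A₁ = (λ r → iter ρ (toℕ r) (0 mod ℓ))
     , (λ r → iter σ (toℕ r) (0 mod m))
     , (λ r → iter τ (toℕ r) (0 mod n))

  -- passage from A^(k-1) to A^(k) for k > 1;
  -- "k ≡ 1 (mod λ)" is  λ ∣ k - 1
  step : ℕ → Matrix → Matrix
  step k (c , d , e) with lam ∣? (k ∸ 1)
  ... | yes _ = c , (λ r → σ (d r)) , e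
  ... | no  _ = c , d , (λ r → τ (e r))

  -- A k = A^(k) for k ≥ 1 (A 0 is an unused dummy)
  A : ℕ → Matrix
  A zero          = A₁
  A (suc zero)    = A₁
  A (suc (suc k)) = step (suc (suc k)) (A (suc k))

-- Row r of A^(k) is obtained from row r of A^(1) by a fixed power of the
-- bijection id × σ × τ, so it suffices to treat A^(1).  Row r of A^(1)
-- is (r mod ℓ, r mod m, r mod n); if rows r ≤ s agree, then ℓ, m and n
-- all divide s - r, hence so does L, and 0 ≤ s - r < L forces r = s.
module Submission where

open import Defs
open import Data.Nat
open import Data.Nat.Properties
open import Data.Nat.DivMod
open import Data.Nat.Divisibility
open import Data.Nat.LCM using (lcm-least)
open import Data.Fin using (Fin; toℕ)
open import Data.Fin.Properties using (toℕ-fromℕ<; toℕ<n; toℕ-injective)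
open import Data.Product using (_,_; proj₁; proj₂)
open import Data.Sum using (inj₁; inj₂)
open import Function.Base using (_∘_)
open import Function.Definitions using (Injective)
open import Relation.Nullary using (yes; no; contradiction)
open import Relation.Binary.PropositionalEquality

toℕ-mod : ∀ a p .{{_ : NonZero p}} → toℕ (a mod p) ≡ a % p
toℕ-mod a p = toℕ-fromℕ< (m%n<n a p)

suc-%-% : ∀ a p .{{_ : NonZero p}} → suc (a % p) % p ≡ suc a % p
suc-%-% a p = begin
  (1 + a % p) % p               ≡⟨ [m+kn]%n≡m%n (1 + a % p) (a / p) p ⟨
  (1 + a % p + a / p * p) % p   ≡⟨ cong (_% p) (+-assoc 1 (a % p) (a / p * p)) ⟩
  (1 + (a % p + a / p * p)) % p ≡⟨ cong (λ b → suc b % p) (m≡m%n+[m/n]*n a p) ⟨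
  suc a % p                     ∎
  where open ≡-Reasoning

iter-comm : ∀ {A : Set} (f : A → A) t x → iter f t (f x) ≡ f (iter f t x)
iter-comm f zero    x = refl
iter-comm f (suc t) x = cong f (iter-comm f t x)

toℕ-iter-cyc : ∀ {p} .{{_ : NonZero p}} t (x : Fin p) → toℕ (iter cyc t x) ≡ (t + toℕ x) % p
toℕ-iter-cyc {suc q} zero    x = sym (m<n⇒m%n≡m (toℕ<n x))
toℕ-iter-cyc {suc q} (suc t) x = begin
  toℕ (cyc (iter cyc t x))          ≡⟨ toℕ-mod (suc (toℕ (iter cyc t x))) (suc q) ⟩
  suc (toℕ (iter cyc t x)) % suc q  ≡⟨ cong (λ a → suc a % suc q) (toℕ-iter-cyc t x) ⟩
  suc ((t + toℕ x) % suc q) % suc q ≡⟨ suc-%-% (t + toℕ x) (suc q) ⟩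
  suc (t + toℕ x) % suc q           ∎
  where open ≡-Reasoning

iter-cyc-period : ∀ {p} .{{_ : NonZero p}} (x : Fin p) → iter cyc p x ≡ x
iter-cyc-period {p} x = toℕ-injective (begin
  toℕ (iter cyc p x) ≡⟨ toℕ-iter-cyc p x ⟩
  (p + toℕ x) % p    ≡⟨ cong (_% p) (+-comm p (toℕ x)) ⟩
  (toℕ x + p) % p    ≡⟨ [m+n]%n≡m%n (toℕ x) p ⟩
  toℕ x % p          ≡⟨ m<n⇒m%n≡m (toℕ<n x) ⟩
  toℕ x              ∎)
  where open ≡-Reasoning

cyc-injective : ∀ {p} → Injective _≡_ _≡_ (cyc {p})
cyc-injective {suc q} {x} {y} cx≡cy = begin
  x                     ≡⟨ iter-cyc-period x ⟨
  cyc (iter cyc q x)    ≡⟨ iter-comm cyc q x ⟨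
  iter cyc q (cyc x)    ≡⟨ cong (iter cyc q) cx≡cy ⟩
  iter cyc q (cyc y)    ≡⟨ iter-comm cyc q y ⟩
  cyc (iter cyc q y)    ≡⟨ iter-cyc-period y ⟩
  y                     ∎
  where open ≡-Reasoning

%-≡⇒∣∸ : ∀ t u p .{{_ : NonZero p}} → t % p ≡ u % p → p ∣ u ∸ t
%-≡⇒∣∸ t u p t%p≡u%p = divides (u / p ∸ t / p) (begin
  u ∸ t                                     ≡⟨ cong₂ _∸_ (m≡m%n+[m/n]*n u p) (m≡m%n+[m/n]*n t p) ⟩
  (u % p + u / p * p) ∸ (t % p + t / p * p) ≡⟨ cong (λ a → (u % p + u / p * p) ∸ (a + t / p * p)) t%p≡u%p ⟩
  (u % p + u / p * p) ∸ (u % p + t / p * p) ≡⟨ [m+n]∸[m+o]≡n∸o (u % p) (u / p * p) (t / p * p) ⟩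
  u / p * p ∸ t / p * p                     ≡⟨ *-distribʳ-∸ p (u / p) (t / p) ⟨
  (u / p ∸ t / p) * p                       ∎)
  where open ≡-Reasoning

iter-cyc-0-≡⇒∣∸ : ∀ p .{{_ : NonZero p}} t u →
                    iter cyc t (0 mod p) ≡ iter cyc u (0 mod p) → p ∣ u ∸ t
iter-cyc-0-≡⇒∣∸ p@(suc _) t u eq = %-≡⇒∣∸ t u p (begin
  t % p                      ≡⟨ cong (_% p) (+-identityʳ t) ⟨
  (t + 0) % p                ≡⟨ toℕ-iter-cyc t (0 mod p) ⟨
  toℕ (iter cyc t (0 mod p)) ≡⟨ cong toℕ eq ⟩
  toℕ (iter cyc u (0 mod p)) ≡⟨ toℕ-iter-cyc u (0 mod p) ⟩
  (u + 0) % p                ≡⟨ cong (_% p) (+-identityʳ u) ⟩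
  u % p                      ∎)
  where open ≡-Reasoning

∣∧<⇒≡0 : ∀ {d x} → d ∣ x → x < d → x ≡ 0
∣∧<⇒≡0 {x = zero}  _   _   = refl
∣∧<⇒≡0 {x = suc _} d∣x x<d = contradiction d∣x (>⇒∤ x<d)

module _ (ℓ m n : ℕ) (hℓ : 2 ≤ ℓ) (hm : 2 ≤ m) (hn : 2 ≤ n) where
  open Construction ℓ m n hℓ hm hn

  row-step-reflects-≡ : ∀ k M r s → row (step k M) r ≡ row (step k M) s → row M r ≡ row M s
  row-step-reflects-≡ k (c , d , e) r s eq with lam ∣? (k ∸ 1)
  ... | yes _ = cong₂ _,_ (cong proj₁ eq)
                  (cong₂ _,_ (cyc-injective (cong (proj₁ ∘ proj₂) eq)) (cong (proj₂ ∘ proj₂) eq))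
  ... | no  _ = cong₂ _,_ (cong proj₁ eq)
                  (cong₂ _,_ (cong (proj₁ ∘ proj₂) eq) (cyc-injective (cong (proj₂ ∘ proj₂) eq)))

  row-A-reflects-≡ : ∀ k r s → row (A k) r ≡ row (A k) s → row A₁ r ≡ row A₁ s
  row-A-reflects-≡ zero          r s eq = eq
  row-A-reflects-≡ (suc zero)    r s eq = eq
  row-A-reflects-≡ (suc (suc k)) r s eq =
    row-A-reflects-≡ (suc k) r s (row-step-reflects-≡ (suc (suc k)) (A (suc k)) r s eq)

  row-A₁-≡⇒≥ : (r s : Fin L) → toℕ r ≤ toℕ s → row A₁ r ≡ row A₁ s → toℕ s ≤ toℕ r
  row-A₁-≡⇒≥ r s r≤s eq = m∸n≡0⇒m≤n (∣∧<⇒≡0 L∣s∸r (≤-<-trans (m∸n≤m (toℕ s) (toℕ r)) (toℕ<n s)))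
    where
    L∣s∸r : L ∣ toℕ s ∸ toℕ r
    L∣s∸r = lcm-least
      (lcm-least (iter-cyc-0-≡⇒∣∸ ℓ (toℕ r) (toℕ s) (cong proj₁ eq))
                 (iter-cyc-0-≡⇒∣∸ m (toℕ r) (toℕ s) (cong (proj₁ ∘ proj₂) eq)))
      (iter-cyc-0-≡⇒∣∸ n (toℕ r) (toℕ s) (cong (proj₂ ∘ proj₂) eq))

  row-A₁-injective : ∀ r s → row A₁ r ≡ row A₁ s → r ≡ s
  row-A₁-injective r s eq with ≤-total (toℕ r) (toℕ s)
  ... | inj₁ r≤s = toℕ-injective (≤-antisym r≤s (row-A₁-≡⇒≥ r s r≤s eq))
  ... | inj₂ s≤r = toℕ-injective (≤-antisym (row-A₁-≡⇒≥ s r s≤r (sym eq)) s≤r)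

mainTheorem3 : (ℓ m n : ℕ) (hℓ : 2 ≤ ℓ) (hm : 2 ≤ m) (hn : 2 ≤ n) →
    (k : ℕ) → 1 ≤ k → k ≤ Construction.numMatrices ℓ m n hℓ hm hn →
    (r s : Fin (Construction.L ℓ m n hℓ hm hn)) →
    Construction.row ℓ m n hℓ hm hn (Construction.A ℓ m n hℓ hm hn k) r
      ≡ Construction.row ℓ m n hℓ hm hn (Construction.A ℓ m n hℓ hm hn k) s →
    r ≡ s
mainTheorem3 ℓ m n hℓ hm hn k _ _ r s eq =
  row-A₁-injective ℓ m n hℓ hm hn r s (row-A-reflects-≡ ℓ m n hℓ hm hn k r s eq)
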